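{- Let $q$ be a prime number. Then for any multiplicative $IP^{\star}$ set $B\subseteq\mathbb{N}$ there exists a multiplicative $IP^{\star}$ set $A\subseteq B$ such that for every $n\in\mathbb{N}$, the set $A/q^{n}$ is not a multiplicative $IP^{\star}$ set.
   Context: $\mathbb{N}=\{1,2,3,\dots\}$. For a sequence $\langle x_n\rangle_{n}$ in $\mathbb{N}$, $FP(\langle x_n\rangle_n)=\{\prod_{t\in H}x_t : H \text{ a nonempty finite subset of }\mathbb{N}\}$. A multiplicative $IP$ set is a set of the form $FP(\langle x_n\rangle_{n\in\mathbb{N}})$ for some injective sequence in $\mathbb{N}$; a multiplicative $IP^{\star}$ set is a subset of $\mathbb{N}$ meeting every multiplicative $IP$ set. For $A\subseteq\mathbb{N}$ and $m\in\mathbb{N}$, $A/m=\{x\in\mathbb{N}: mx\in A\}$. -}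

module Defs where

open import Data.Nat using (ℕ; NonZero; _*_)
open import Data.List using (List; []; map)
open import Data.Nat.ListAction using (product)
open import Data.List.Relation.Unary.Unique.Propositional using (Unique)
open import Data.Product using (Σ; ∃; _×_)
open import Relation.Binary.PropositionalEquality using (_≡_; _≢_)
open import Function.Definitions using (Injective)

-- Subsets of ℕ = {1,2,3,...} are modelled as predicates on Agda's ℕ;
-- the value at 0 is irrelevant for all notions below.
NSet : Set₁
NSet = ℕ → Set

PosSeq : (ℕ → ℕ) → Set
PosSeq x = ∀ n → NonZero (x n)

-- FP(⟨x_n⟩): products over nonempty finite sets H of indices,
-- H given as a nonempty duplicate-free list.
FP : (ℕ → ℕ) → NSet
FP x m = Σ (List ℕ) λ H → (H ≢ []) × Unique H × (product (map x H) ≡ m)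

IsMultIP : NSet → Set
IsMultIP A = Σ (ℕ → ℕ) λ x → PosSeq x × Injective _≡_ _≡_ x × (∀ m → A m → FP x m) × (∀ m → FP x m → A m)

-- A is a multiplicative IP⋆ set: meets every multiplicative IP set,
-- i.e. every FP(⟨x_n⟩) with ⟨x_n⟩ an injective sequence in ℕ.
IsMultIPStar : NSet → Set
IsMultIPStar A = ∀ (x : ℕ → ℕ) → PosSeq x → Injective _≡_ _≡_ x → ∃ λ m → FP x m × A m

_/ₘ_ : NSet → ℕ → NSet
(A /ₘ m) x = A (m * x)

_⊆ₙ_ : NSet → NSet → Set
A ⊆ₙ B = ∀ m → A m → B m

-- Put r = q + 1 and s = q r + 1.  Since r ≡ s ≡ 1 (mod q) and s ≡ 1 (mod r),
-- the exponents of m = q^a r^b s^c are determined by m.  Let D be the set of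
-- q^n r^(n t) s^t with n, t ≥ 1, i.e. the exponent triples on the "diagonal"
-- b = a c.  Exponents add under multiplication and (a + a')(c + c') exceeds
-- a c + a' c', so a product of two or more elements of D lies strictly below
-- the diagonal and is not in D.  This makes B ∖ D an IP⋆ set: given an
-- injective sequence x, take disjoint blocks of indices whose products u₀, u₁,
-- u₂, … lie in B and increase, and let yⱼ = u₂ⱼ u₂ⱼ₊₁.  Some element of FP(y)
-- lies in B; it is a product of at least two u's, so either one of those u's
-- is not in D, or the product itself is not in D — in both cases an element
-- of FP(x) ∩ (B ∖ D).  On the other hand, with g = r^k s, every element of
-- FP(g, g², g³, …) is a power g^T = r^(k T) s^T, so q^k FP(gⁱ) ⊆ D and
-- (B ∖ D)/q^k misses an IP set.
module Submission where

open import Defs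
open import Data.Nat using (ℕ; suc; _^_; NonZero)
open import Data.Nat.Primality using (Prime)
open import Data.Product using (Σ; _×_)
open import Relation.Nullary using (¬_)

open import Data.Nat
  using (zero; _+_; _*_; z<s; _≤_; _<_; _≤′_; ≤′-refl; ≤′-step; z≤n; s≤s;
         >-nonZero; nonTrivial⇒n>1)
open import Data.Nat.Properties
open import Data.Nat.Divisibility using (_∣_; ∣1⇒≡1; ∣m+n∣m⇒∣n; n∣m*n; m∣m*n)
open import Data.Nat.Primality using (prime⇒nonTrivial)
open import Data.Nat.Tactic.RingSolver using (solve-∀)
open import Data.Nat.ListAction using (product; sum)
open import Data.Nat.ListAction.Properties using (product-++; product≢0)
open import Data.Product using (∃; ∃₂; _,_; proj₁; proj₂)
open import Data.Empty using (⊥; ⊥-elim)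
open import Data.Fin using (Fin; toℕ; fromℕ<)
open import Data.Fin.Properties using (pigeonhole; toℕ-fromℕ<; toℕ<n)
open import Data.List using (List; []; _∷_; _++_; map; concatMap)
open import Data.List.Properties using (map-++; map-∘; ++-conicalˡ)
open import Data.List.Extrema.Nat using (max; xs≤max)
open import Data.List.Membership.Propositional.Properties using (∈-concatMap⁻)
open import Data.List.Relation.Binary.Disjoint.Propositional using (Disjoint)
open import Data.List.Relation.Unary.All as All using (All; []; _∷_)
import Data.List.Relation.Unary.All.Properties as All
import Data.List.Relation.Unary.Any as Any
open import Data.List.Relation.Unary.Unique.Propositional using (Unique; []; _∷_)
import Data.List.Relation.Unary.Unique.Propositional.Properties as Unique
open import Function using (_∘_)
open import Function.Definitions using (Injective)
open import Relation.Binary.Definitions using (tri<; tri≈; tri>)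
open import Relation.Binary.PropositionalEquality
open import Relation.Nullary using (yes; no; map′)
open import Relation.Unary using (Decidable)

*-+-superadditive : ∀ a a' c c' → a * c + a' * c' + a * c' ≤ (a + a') * (c + c')
*-+-superadditive a a' c c' = begin
  a * c + a' * c' + a * c'             ≤⟨ +-monoʳ-≤ (a * c + a' * c') (m≤m+n (a * c') (a' * c)) ⟩
  a * c + a' * c' + (a * c' + a' * c)  ≡⟨ sym (*-+-expand a a' c c') ⟩
  (a + a') * (c + c')                  ∎
  where
  open ≤-Reasoning
  *-+-expand : ∀ a a' c c' → (a + a') * (c + c') ≡ a * c + a' * c' + (a * c' + a' * c)
  *-+-expand = solve-∀

*-^-distrib : ∀ m n k → (m * n) ^ k ≡ m ^ k * n ^ k
*-^-distrib m n zero    = refl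
*-^-distrib m n (suc k) = trans (cong (m * n *_) (*-^-distrib m n k)) (interchange m n (m ^ k) (n ^ k))
  where
  interchange : ∀ a b c d → a * b * (c * d) ≡ a * c * (b * d)
  interchange = solve-∀

product-map-^ : ∀ g (f : ℕ → ℕ) H → product (map (λ i → g ^ f i) H) ≡ g ^ sum (map f H)
product-map-^ g f []      = refl
product-map-^ g f (h ∷ H) =
  trans (cong (g ^ f h *_) (product-map-^ g f H)) (sym (^-distribˡ-+-* g (f h) (sum (map f H))))

infix 4 _≡1[mod_]

_≡1[mod_] : ℕ → ℕ → Set
m ≡1[mod p ] = ∃ λ k → m ≡ suc (k * p)

1≡1[mod] : ∀ p → 1 ≡1[mod p ]
1≡1[mod] p = 0 , refl

*-≡1[mod] : ∀ {p m n} → m ≡1[mod p ] → n ≡1[mod p ] → m * n ≡1[mod p ]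
*-≡1[mod] {p} (k , refl) (l , refl) = k + l + k * l * p , expand k l p
  where
  expand : ∀ k l p → suc (k * p) * suc (l * p) ≡ suc ((k + l + k * l * p) * p)
  expand = solve-∀

^-≡1[mod] : ∀ {p m} → m ≡1[mod p ] → ∀ n → m ^ n ≡1[mod p ]
^-≡1[mod] {p} m≡1 zero    = 1≡1[mod] p
^-≡1[mod] {p} m≡1 (suc n) = *-≡1[mod] m≡1 (^-≡1[mod] m≡1 n)

≡1[mod]⇒∤ : ∀ {p m} → 1 < p → m ≡1[mod p ] → ¬ (p ∣ m)
≡1[mod]⇒∤ {p} 1<p (k , refl) p∣m = <⇒≢ 1<p (sym (∣1⇒≡1 p∣1))
  where
  p∣1 : p ∣ 1
  p∣1 = ∣m+n∣m⇒∣n (subst (p ∣_) (+-comm 1 (k * p)) p∣m) (n∣m*n k)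

^*≡1[mod]-injective : ∀ {p X Y} → 1 < p → X ≡1[mod p ] → Y ≡1[mod p ] →
  ∀ a b → p ^ a * X ≡ p ^ b * Y → a ≡ b × X ≡ Y
^*≡1[mod]-injective {p} {X} {Y} 1<p X≡1 Y≡1 = go
  where
  instance
    p≢0 : NonZero p
    p≢0 = >-nonZero (<-trans z<s 1<p)

  p∣p^1+a*Z : ∀ a Z → p ∣ p ^ suc a * Z
  p∣p^1+a*Z a Z = subst (p ∣_) (sym (*-assoc p (p ^ a) Z)) (m∣m*n (p ^ a * Z))

  go : ∀ a b → p ^ a * X ≡ p ^ b * Y → a ≡ b × X ≡ Y
  go zero    zero    eq = refl , trans (sym (*-identityˡ X)) (trans eq (*-identityˡ Y))
  go zero    (suc b) eq = ⊥-elim (≡1[mod]⇒∤ 1<p X≡1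
    (subst (p ∣_) (trans (sym eq) (*-identityˡ X)) (p∣p^1+a*Z b Y)))
  go (suc a) zero    eq = ⊥-elim (≡1[mod]⇒∤ 1<p Y≡1
    (subst (p ∣_) (trans eq (*-identityˡ Y)) (p∣p^1+a*Z a X)))
  go (suc a) (suc b) eq with go a b (*-cancelˡ-≡ (p ^ a * X) (p ^ b * Y) p
    (trans (sym (*-assoc p (p ^ a) X)) (trans eq (*-assoc p (p ^ b) Y))))
  ... | refl , X≡Y = refl , X≡Y

StrictlyIncreasing : (ℕ → ℕ) → Set
StrictlyIncreasing f = ∀ i → f i < f (suc i)

module _ {f : ℕ → ℕ} (f-inc : StrictlyIncreasing f) where

  strictlyIncreasing-mono-≤ : ∀ {i j} → i ≤ j → f i ≤ f j
  strictlyIncreasing-mono-≤ = go ∘ ≤⇒≤′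
    where
    go : ∀ {i j} → i ≤′ j → f i ≤ f j
    go ≤′-refl         = ≤-refl
    go (≤′-step i≤′j) = ≤-trans (go i≤′j) (<⇒≤ (f-inc _))

  strictlyIncreasing-mono-< : ∀ {i j} → i < j → f i < f j
  strictlyIncreasing-mono-< {i} i<j = <-≤-trans (f-inc i) (strictlyIncreasing-mono-≤ i<j)

  strictlyIncreasing⇒injective : Injective _≡_ _≡_ f
  strictlyIncreasing⇒injective {i} {j} fi≡fj with <-cmp i j
  ... | tri< i<j _ _ = ⊥-elim (<⇒≢ (strictlyIncreasing-mono-< i<j) fi≡fj)
  ... | tri≈ _ i≡j _ = i≡j
  ... | tri> _ _ j<i = ⊥-elim (<⇒≢ (strictlyIncreasing-mono-< j<i) (sym fi≡fj))

  strictlyIncreasing-≥ : ∀ n → f 0 + n ≤ f n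
  strictlyIncreasing-≥ zero    = ≤-reflexive (+-identityʳ (f 0))
  strictlyIncreasing-≥ (suc n) = begin
    f 0 + suc n    ≡⟨ +-suc (f 0) n ⟩
    suc (f 0 + n)  ≤⟨ s≤s (strictlyIncreasing-≥ n) ⟩
    suc (f n)      ≤⟨ f-inc n ⟩
    f (suc n)      ∎
    where open ≤-Reasoning

^-strictlyIncreasing : ∀ {g} → 1 < g → StrictlyIncreasing (g ^_)
^-strictlyIncreasing {g} 1<g i = ^-monoʳ-< g 1<g (n<1+n i)

n<m^n : ∀ {m} → 1 < m → ∀ n → n < m ^ n
n<m^n 1<m = strictlyIncreasing-≥ (^-strictlyIncreasing 1<m)

FP-nonZero : ∀ {x} → PosSeq x → ∀ {m} → FP x m → NonZero m
FP-nonZero x-pos (H , _ , _ , ∏≡m) = subst NonZero ∏≡m (product≢0 (All.map⁺ (All.universal x-pos H)))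

module _ {x : ℕ → ℕ} (x-pos : PosSeq x) (x-inj : Injective _≡_ _≡_ x) where

  ¬bounded-run : ∀ a v → ¬ (∀ (k : Fin (suc v)) → x (a + toℕ k) ≤ v)
  ¬bounded-run a v bounded = collision (pigeonhole (n<1+n v) squash)
    where
    squash : Fin (suc v) → Fin v
    squash k = fromℕ< (pred-mono-< {{x-pos (a + toℕ k)}} (s≤s (bounded k)))

    squash-injective : ∀ {i j} → squash i ≡ squash j → toℕ i ≡ toℕ j
    squash-injective {i} {j} eq = +-cancelˡ-≡ a _ _ (x-inj
      (pred-injective {{x-pos (a + toℕ i)}} {{x-pos (a + toℕ j)}}
        (trans (sym (toℕ-fromℕ< _)) (trans (cong toℕ eq) (toℕ-fromℕ< _)))))

    collision : (∃₂ λ i j → toℕ i < toℕ j × squash i ≡ squash j) → ⊥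
    collision (i , j , i<j , eq) = <⇒≢ i<j (squash-injective eq)

  exceeds-after : ∀ a v → ∃ λ i → a ≤ i × v < x i
  exceeds-after a v with anyUpTo? (λ k → v <? x (a + k)) (suc v)
  ... | yes (k , _ , v<x) = a + k , m≤m+n a k , v<x
  ... | no none = ⊥-elim (¬bounded-run a v λ k → ≮⇒≥ λ v<x → none (toℕ k , toℕ<n k , v<x))

  subsequence-exceeding : ∀ a v →
    ∃ λ σ → StrictlyIncreasing σ × (∀ i → a ≤ σ i) × (∀ i → v < x (σ i))
  subsequence-exceeding a v = σ , σ-inc , a≤σ , v<xσ
    where
    σ : ℕ → ℕ
    σ zero    = proj₁ (exceeds-after a v)
    σ (suc i) = proj₁ (exceeds-after (suc (σ i)) v)

    σ-inc : StrictlyIncreasing σ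
    σ-inc i = proj₁ (proj₂ (exceeds-after (suc (σ i)) v))

    a≤σ : ∀ i → a ≤ σ i
    a≤σ zero    = proj₁ (proj₂ (exceeds-after a v))
    a≤σ (suc i) = ≤-trans (a≤σ i) (<⇒≤ (σ-inc i))

    v<xσ : ∀ i → v < x (σ i)
    v<xσ zero    = proj₂ (proj₂ (exceeds-after a v))
    v<xσ (suc i) = proj₂ (proj₂ (exceeds-after (suc (σ i)) v))

-- Segments of indices

module Segments (x : ℕ → ℕ) where

  InRange : ℕ → ℕ → ℕ → Set
  InRange lo hi e = lo ≤ e × e < hi

  record Segment (lo hi : ℕ) : Set where
    field
      indices  : List ℕ
      nonempty : indices ≢ []
      unique   : Unique indices
      in-range : All (InRange lo hi) indices

    value : ℕ
    value = product (map x indices)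

    value-FP : FP x value
    value-FP = indices , nonempty , unique , refl

  open Segment public

  lo<hi : ∀ {lo hi} → Segment lo hi → lo < hi
  lo<hi S with indices S | nonempty S | in-range S
  ... | []    | ≢[] | _                 = ⊥-elim (≢[] refl)
  ... | _ ∷ _ | _   | (lo≤e , e<hi) ∷ _ = ≤-<-trans lo≤e e<hi

  _⁀_ : ∀ {lo mid hi} → Segment lo mid → Segment mid hi → Segment lo hi
  S ⁀ T = record
    { indices  = indices S ++ indices T
    ; nonempty = nonempty S ∘ ++-conicalˡ (indices S) (indices T)
    ; unique   = Unique.++⁺ (unique S) (unique T) disjoint
    ; in-range = All.++⁺
        (All.map (λ (lo≤e , e<mid) → lo≤e , <-trans e<mid (lo<hi T)) (in-range S))
        (All.map (λ (mid≤e , e<hi) → ≤-trans (<⇒≤ (lo<hi S)) mid≤e , e<hi) (in-range T))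
    }
    where
    disjoint : Disjoint (indices S) (indices T)
    disjoint (e∈S , e∈T) =
      <⇒≱ (proj₂ (All.lookup (in-range S) e∈S)) (proj₁ (All.lookup (in-range T) e∈T))

  value-⁀ : ∀ {lo mid hi} (S : Segment lo mid) (T : Segment mid hi) →
    value (S ⁀ T) ≡ value S * value T
  value-⁀ S T = trans (cong product (map-++ x (indices S) (indices T)))
                      (product-++ (map x (indices S)) (map x (indices T)))

  module _ (lo : ℕ → ℕ) (S : ∀ i → Segment (lo i) (lo (suc i))) where

    private
      block : ℕ → List ℕ
      block i = indices (S i)

      lo-mono : ∀ {i j} → i ≤ j → lo i ≤ lo j
      lo-mono = strictlyIncreasing-mono-≤ (λ k → lo<hi (S k))

    InRange-unique : ∀ {i j e} → InRange (lo i) (lo (suc i)) e → InRange (lo j) (lo (suc j)) e → i ≡ j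
    InRange-unique {i} {j} (lo≤e , e<hi) (lo'≤e , e<hi') with <-cmp i j
    ... | tri< i<j _ _ = ⊥-elim (<⇒≱ e<hi (≤-trans (lo-mono i<j) lo'≤e))
    ... | tri≈ _ i≡j _ = i≡j
    ... | tri> _ _ j<i = ⊥-elim (<⇒≱ e<hi' (≤-trans (lo-mono j<i) lo≤e))

    concatMap-unique : ∀ {H} → Unique H → Unique (concatMap block H)
    concatMap-unique []                       = []
    concatMap-unique {h ∷ H} (h∉H ∷ H-unique) =
      Unique.++⁺ (unique (S h)) (concatMap-unique H-unique) disjoint
      where
      disjoint : Disjoint (block h) (concatMap block H)
      disjoint (e∈h , e∈H) = All.All¬⇒¬Any h∉H (Any.map
        (λ {h'} e∈h' → InRange-unique (All.lookup (in-range (S h)) e∈h) (All.lookup (in-range (S h')) e∈h'))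
        (∈-concatMap⁻ block e∈H))

    concatMap-≢[] : ∀ H → H ≢ [] → concatMap block H ≢ []
    concatMap-≢[] []      H≢[] = λ _ → H≢[] refl
    concatMap-≢[] (h ∷ H) _    = nonempty (S h) ∘ ++-conicalˡ (block h) (concatMap block H)

    concatMap-value : ∀ H → product (map x (concatMap block H)) ≡ product (map (λ i → value (S i)) H)
    concatMap-value []      = refl
    concatMap-value (h ∷ H) = begin
      product (map x (block h ++ concatMap block H))
        ≡⟨ cong product (map-++ x (block h) (concatMap block H)) ⟩
      product (map x (block h) ++ map x (concatMap block H))
        ≡⟨ product-++ (map x (block h)) (map x (concatMap block H)) ⟩
      value (S h) * product (map x (concatMap block H))
        ≡⟨ cong (value (S h) *_) (concatMap-value H) ⟩
      value (S h) * product (map (λ i → value (S i)) H)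
        ∎
      where open ≡-Reasoning

    segments-FP : ∀ {m} → FP (λ i → value (S i)) m → FP x m
    segments-FP (H , H≢[] , H-unique , ∏≡m) =
      concatMap block H , concatMap-≢[] H H≢[] , concatMap-unique H-unique , trans (concatMap-value H) ∏≡m

-- Removing a product-avoiding set from an IP⋆ set

ProductAvoiding : NSet → Set
ProductAvoiding D = ∀ a b l → All D (a ∷ b ∷ l) → ¬ D (product (a ∷ b ∷ l))

¬IP⋆-if-missing : ∀ {A x} → PosSeq x → Injective _≡_ _≡_ x → (∀ {m} → FP x m → ¬ A m) → ¬ IsMultIPStar A
¬IP⋆-if-missing x-pos x-inj misses A-IP⋆ with A-IP⋆ _ x-pos x-inj
... | m , m∈FP , m∈A = misses m∈FP m∈A

module Stages {B : NSet} (B-IP⋆ : IsMultIPStar B)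
              {x : ℕ → ℕ} (x-pos : PosSeq x) (x-inj : Injective _≡_ _≡_ x) where

  open Segments x

  record Piece (lo v : ℕ) : Set where
    field
      hi      : ℕ
      segment : Segment lo hi
      in-B    : B (value segment)
      large   : v < value segment

  open Piece

  pieceAlong : ∀ {lo v} (σ : ℕ → ℕ) → Injective _≡_ _≡_ σ → (∀ i → lo ≤ σ i) → (∀ i → v < x (σ i)) →
    ∀ {m} → FP (x ∘ σ) m → B m → Piece lo v
  pieceAlong σ σ-inj lo≤σ v<xσ ([] , []≢[] , _) _ = ⊥-elim ([]≢[] refl)
  pieceAlong {lo} {v} σ σ-inj lo≤σ v<xσ {m} (H@(h ∷ H′) , _ , H-unique , ∏≡m) m∈B = record
    { hi      = suc (max 0 K)
    ; segment = seg
    ; in-B    = subst B (sym value≡m) m∈B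
    ; large   = subst (v <_) (sym value≡m) (subst (v <_) ∏≡m v<∏)
    }
    where
    K : List ℕ
    K = map σ H

    seg : Segment lo (suc (max 0 K))
    seg = record
      { indices  = K
      ; nonempty = λ ()
      ; unique   = Unique.map⁺ σ-inj H-unique
      ; in-range = All.zip (All.map⁺ (All.universal lo≤σ H) , All.map s≤s (xs≤max 0 K))
      }

    value≡m : value seg ≡ m
    value≡m = trans (cong product (sym (map-∘ {g = x} {f = σ} H))) ∏≡m

    v<∏ : v < product (map (x ∘ σ) H)
    v<∏ = m<n⇒m<n*o _ {{product≢0 (All.map⁺ (All.universal (x-pos ∘ σ) H′))}} (v<xσ h)

  piece : ∀ lo v → Piece lo v
  piece lo v with subsequence-exceeding x-pos x-inj lo v
  ... | σ , σ-inc , lo≤σ , v<xσ with B-IP⋆ (x ∘ σ) (x-pos ∘ σ) (strictlyIncreasing⇒injective σ-inc ∘ x-inj)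
  ... | m , m∈FP , m∈B = pieceAlong σ (strictlyIncreasing⇒injective σ-inc) lo≤σ v<xσ m∈FP m∈B

  record Stage : Set where
    field
      lo bound : ℕ
      left     : Piece lo bound
      right    : Piece (hi left) bound

    joined : Segment lo (hi right)
    joined = segment left ⁀ segment right

    leftValue rightValue : ℕ
    leftValue  = value (segment left)
    rightValue = value (segment right)

    joined-value : value joined ≡ leftValue * rightValue
    joined-value = value-⁀ (segment left) (segment right)

    factors : List ℕ
    factors = leftValue ∷ rightValue ∷ []

  open Stage

  stageAt : ℕ → ℕ → Stage
  stageAt lo v = record { lo = lo ; bound = v ; left = piece lo v ; right = piece _ v }

  stage : ℕ → Stage
  stage zero    = stageAt 0 0
  stage (suc j) = stageAt (hi (right (stage j))) (value (joined (stage j)))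

  y : ℕ → ℕ
  y j = value (joined (stage j))

  bound<y : ∀ j → bound (stage j) < y j
  bound<y j = subst (bound (stage j) <_) (sym (joined-value (stage j)))
    (m<n⇒m<n*o _ {{>-nonZero (≤-<-trans z≤n (large (right (stage j))))}} (large (left (stage j))))

  y-increasing : StrictlyIncreasing y
  y-increasing j = bound<y (suc j)

  y-pos : PosSeq y
  y-pos j = >-nonZero (≤-<-trans z≤n (bound<y j))

  FP-y⇒FP-x : ∀ {m} → FP y m → FP x m
  FP-y⇒FP-x = segments-FP (λ j → lo (stage j)) (λ j → joined (stage j))

  stageFactors : List ℕ → List ℕ
  stageFactors = concatMap (λ j → factors (stage j))

  stageFactors-product : ∀ H → product (stageFactors H) ≡ product (map y H)
  stageFactors-product []      = refl
  stageFactors-product (j ∷ H) = begin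
    u * (w * product (stageFactors H))  ≡⟨ sym (*-assoc u w _) ⟩
    u * w * product (stageFactors H)    ≡⟨ cong₂ _*_ (sym (joined-value (stage j))) (stageFactors-product H) ⟩
    y j * product (map y H)             ∎
    where
    open ≡-Reasoning
    u = leftValue (stage j)
    w = rightValue (stage j)

  stageFactors-good : ∀ H → All (λ e → B e × FP x e) (stageFactors H)
  stageFactors-good []      = []
  stageFactors-good (j ∷ H) =
    (in-B (left (stage j)) , value-FP (segment (left (stage j)))) ∷
    (in-B (right (stage j)) , value-FP (segment (right (stage j)))) ∷
    stageFactors-good H

IP⋆-without : ∀ {B D} → IsMultIPStar B → Decidable D → ProductAvoiding D →
  IsMultIPStar (λ m → NonZero m × B m × ¬ D m)
IP⋆-without {B} {D} B-IP⋆ D? D-avoiding x x-pos x-inj =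
  witness (B-IP⋆ y y-pos (strictlyIncreasing⇒injective y-increasing))
  where
  open Stages B-IP⋆ x-pos x-inj

  ¬D-product : ∀ H → H ≢ [] → All D (stageFactors H) → ¬ D (product (stageFactors H))
  ¬D-product []      H≢[] _ = ⊥-elim (H≢[] refl)
  ¬D-product (j ∷ H) _      = D-avoiding _ _ (stageFactors H)

  witness : (∃ λ m → FP y m × B m) → ∃ λ m → FP x m × NonZero m × B m × ¬ D m
  witness (m , m∈FP@(H , H≢[] , _ , ∏≡m) , m∈B) with All.all? D? (stageFactors H)
  ... | yes all-D = m , FP-y⇒FP-x m∈FP , FP-nonZero x-pos (FP-y⇒FP-x m∈FP) , m∈B ,
          subst (¬_ ∘ D) (trans (stageFactors-product H) ∏≡m) (¬D-product H H≢[] all-D)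
  ... | no ¬all-D with All.lookupAny (stageFactors-good H) (All.¬All⇒Any¬ D? _ ¬all-D)
  ...   | (e∈B , e∈FP) , e∉D = _ , e∈FP , FP-nonZero x-pos e∈FP , e∈B , e∉D

-- The diagonal set

module DiagonalExponents (q : ℕ) (1<q : 1 < q) where

  r s : ℕ
  r = suc q
  s = suc (q * r)

  instance
    q≢0 : NonZero q
    q≢0 = >-nonZero (<-trans z<s 1<q)

  1<r : 1 < r
  1<r = <-trans 1<q (n<1+n q)

  1<s : 1 < s
  1<s = <-≤-trans 1<r (≤-trans (m≤n*m r q) (n≤1+n (q * r)))

  r≡1[q] : r ≡1[mod q ]
  r≡1[q] = 1 , cong suc (sym (*-identityˡ q))

  s≡1[q] : s ≡1[mod q ]
  s≡1[q] = r , cong suc (*-comm q r)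

  s≡1[r] : s ≡1[mod r ]
  s≡1[r] = q , refl

  code : ℕ → ℕ → ℕ → ℕ
  code a b c = q ^ a * (r ^ b * s ^ c)

  code-injective : ∀ a b c a' b' c' → code a b c ≡ code a' b' c' → a ≡ a' × b ≡ b' × c ≡ c'
  code-injective a b c a' b' c' eq
    with refl , eq₁ ← ^*≡1[mod]-injective 1<q
           (*-≡1[mod] (^-≡1[mod] r≡1[q] b) (^-≡1[mod] s≡1[q] c))
           (*-≡1[mod] (^-≡1[mod] r≡1[q] b') (^-≡1[mod] s≡1[q] c')) a a' eq
    with refl , eq₂ ← ^*≡1[mod]-injective 1<r
           (^-≡1[mod] s≡1[r] c) (^-≡1[mod] s≡1[r] c') b b' eq₁
    = refl , refl , strictlyIncreasing⇒injective (^-strictlyIncreasing 1<s) eq₂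

  code-* : ∀ a b c a' b' c' → code a b c * code a' b' c' ≡ code (a + a') (b + b') (c + c')
  code-* a b c a' b' c' = begin
    q ^ a * (r ^ b * s ^ c) * (q ^ a' * (r ^ b' * s ^ c'))
      ≡⟨ interchange (q ^ a) (r ^ b) (s ^ c) (q ^ a') (r ^ b') (s ^ c') ⟩
    q ^ a * q ^ a' * (r ^ b * r ^ b' * (s ^ c * s ^ c'))
      ≡⟨ sym (cong₂ _*_ (^-distribˡ-+-* q a a') (cong₂ _*_ (^-distribˡ-+-* r b b') (^-distribˡ-+-* s c c'))) ⟩
    q ^ (a + a') * (r ^ (b + b') * s ^ (c + c'))
      ∎
    where
    open ≡-Reasoning
    interchange : ∀ a b c a' b' c' → a * (b * c) * (a' * (b' * c')) ≡ a * a' * (b * b' * (c * c'))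
    interchange = solve-∀

  q^a≤code : ∀ a b c → q ^ a ≤ code a b c
  q^a≤code a b c = m≤m*n (q ^ a) (r ^ b * s ^ c) {{m*n≢0 (r ^ b) (s ^ c) {{m^n≢0 r b}} {{m^n≢0 s c}}}}

  s^c≤code : ∀ a b c → s ^ c ≤ code a b c
  s^c≤code a b c = ≤-trans (m≤n*m (s ^ c) (r ^ b) {{m^n≢0 r b}}) (m≤n*m (r ^ b * s ^ c) (q ^ a) {{m^n≢0 q a}})

  diagonal : ℕ → ℕ → ℕ
  diagonal n t = code (suc n) (suc n * suc t) (suc t)

  Diagonal : NSet
  Diagonal m = ∃₂ λ n t → m ≡ diagonal n t

  BelowDiagonal : NSet
  BelowDiagonal m = ∃₂ λ a b → ∃ λ c → m ≡ code a b c × b ≤ a * c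

  StrictlyBelowDiagonal : NSet
  StrictlyBelowDiagonal m = ∃₂ λ a b → ∃ λ c → m ≡ code a b c × b < a * c

  Diagonal⇒BelowDiagonal : ∀ {m} → Diagonal m → BelowDiagonal m
  Diagonal⇒BelowDiagonal (n , t , eq) = suc n , suc n * suc t , suc t , eq , ≤-refl

  BelowDiagonal-product : ∀ {l} → All Diagonal l → BelowDiagonal (product l)
  BelowDiagonal-product []                = 0 , 0 , 0 , refl , z≤n
  BelowDiagonal-product (m∈D ∷ l⊆D) with Diagonal⇒BelowDiagonal m∈D | BelowDiagonal-product l⊆D
  ... | a , b , c , refl , b≤ac | a' , b' , c' , eq' , b'≤a'c' =
    a + a' , b + b' , c + c' , trans (cong (code a b c *_) eq') (code-* a b c a' b' c') ,
    ≤-trans (+-mono-≤ b≤ac b'≤a'c') (≤-trans (m≤m+n _ (a * c')) (*-+-superadditive a a' c c'))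

  Diagonal-*-Diagonal : ∀ {m m'} → Diagonal m → Diagonal m' → StrictlyBelowDiagonal (m * m')
  Diagonal-*-Diagonal (n , t , refl) (n' , t' , refl) =
    a + a' , a * c + a' * c' , c + c' , code-* a (a * c) c a' (a' * c') c' ,
    <-≤-trans (m<m+n (a * c + a' * c') z<s) (*-+-superadditive a a' c c')
    where
    a = suc n
    c = suc t
    a' = suc n'
    c' = suc t'

  StrictlyBelowDiagonal-*-BelowDiagonal : ∀ {m m'} → StrictlyBelowDiagonal m → BelowDiagonal m' →
    StrictlyBelowDiagonal (m * m')
  StrictlyBelowDiagonal-*-BelowDiagonal (a , b , c , refl , b<ac) (a' , b' , c' , refl , b'≤a'c') =
    a + a' , b + b' , c + c' , code-* a b c a' b' c' ,
    <-≤-trans (+-mono-<-≤ b<ac b'≤a'c') (≤-trans (m≤m+n _ (a * c')) (*-+-superadditive a a' c c'))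

  StrictlyBelowDiagonal⇒¬Diagonal : ∀ {m} → StrictlyBelowDiagonal m → ¬ Diagonal m
  StrictlyBelowDiagonal⇒¬Diagonal (a , b , c , refl , b<ac) (n , t , eq)
    with refl , refl , refl ← code-injective a b c (suc n) (suc n * suc t) (suc t) eq = <-irrefl refl b<ac

  Diagonal-productAvoiding : ProductAvoiding Diagonal
  Diagonal-productAvoiding a b l (a∈D ∷ b∈D ∷ l⊆D) = StrictlyBelowDiagonal⇒¬Diagonal
    (subst StrictlyBelowDiagonal (*-assoc a b (product l))
      (StrictlyBelowDiagonal-*-BelowDiagonal (Diagonal-*-Diagonal a∈D b∈D) (BelowDiagonal-product l⊆D)))

  n<diagonal : ∀ n t → n < diagonal n t
  n<diagonal n t = <-≤-trans (<-trans (n<1+n n) (n<m^n 1<q (suc n))) (q^a≤code (suc n) (suc n * suc t) (suc t))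

  t<diagonal : ∀ n t → t < diagonal n t
  t<diagonal n t = <-≤-trans (<-trans (n<1+n t) (n<m^n 1<s (suc t))) (s^c≤code (suc n) (suc n * suc t) (suc t))

  Diagonal? : Decidable Diagonal
  Diagonal? m = map′
    (λ (n , _ , t , _ , eq) → n , t , eq)
    (λ (n , t , eq) → n , subst (n <_) (sym eq) (n<diagonal n t) , t , subst (t <_) (sym eq) (t<diagonal n t) , eq)
    (anyUpTo? (λ n → anyUpTo? (λ t → m ≟ diagonal n t) m) m)

  generator : ℕ → ℕ
  generator k = r ^ suc k * s

  1<generator : ∀ k → 1 < generator k
  1<generator k = <-≤-trans 1<s (m≤n*m s (r ^ suc k) {{m^n≢0 r (suc k)}})

  powers : ℕ → ℕ → ℕ
  powers k i = generator k ^ suc i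

  powers-pos : ∀ k → PosSeq (powers k)
  powers-pos k i = m^n≢0 (generator k) (suc i) {{>-nonZero (<-trans z<s (1<generator k))}}

  powers-injective : ∀ k → Injective _≡_ _≡_ (powers k)
  powers-injective k = strictlyIncreasing⇒injective (λ i → ^-strictlyIncreasing (1<generator k) (suc i))

  q^k*FP-powers⊆Diagonal : ∀ k {m} → FP (powers k) m → Diagonal (q ^ suc k * m)
  q^k*FP-powers⊆Diagonal k ([] , []≢[] , _) = ⊥-elim ([]≢[] refl)
  q^k*FP-powers⊆Diagonal k {m} ((h ∷ H) , _ , _ , ∏≡m) = k , T , cong (q ^ suc k *_) m≡
    where
    T = h + sum (map suc H)
    m≡ : m ≡ r ^ (suc k * suc T) * s ^ suc T
    m≡ = begin
      m                                       ≡⟨ sym ∏≡m ⟩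
      product (map (powers k) (h ∷ H))        ≡⟨ product-map-^ (generator k) suc (h ∷ H) ⟩
      generator k ^ suc T                     ≡⟨ *-^-distrib (r ^ suc k) s (suc T) ⟩
      (r ^ suc k) ^ suc T * s ^ suc T         ≡⟨ cong (_* s ^ suc T) (^-*-assoc r (suc k) (suc T)) ⟩
      r ^ (suc k * suc T) * s ^ suc T         ∎
      where open ≡-Reasoning

lemma2p1 : (q : ℕ) → Prime q → (B : NSet) → IsMultIPStar B →
    Σ NSet λ A → ((∀ m → A m → NonZero m) × A ⊆ₙ B × IsMultIPStar A ×
      (∀ (k : ℕ) → ¬ IsMultIPStar (A /ₘ (q ^ suc k))))
lemma2p1 q q-prime B B-IP⋆ =
  A , (λ _ → proj₁) , (λ _ → proj₁ ∘ proj₂) ,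
  IP⋆-without B-IP⋆ Diagonal? Diagonal-productAvoiding ,
  λ k → ¬IP⋆-if-missing (powers-pos k) (powers-injective k)
          (λ m∈FP (_ , _ , ∉D) → ∉D (q^k*FP-powers⊆Diagonal k m∈FP))
  where
  open DiagonalExponents q (nonTrivial⇒n>1 q {{prime⇒nonTrivial q-prime}})

  A : NSet
  A m = NonZero m × B m × ¬ Diagonal m
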